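{- Let $d\ge 3$, $n\ge 2$, and let $F$ be an $n$-lattice framework in $\mathbb{R}^d$. Suppose that for all $1\le i\le d$ and $0\le c\le n-1$, the framework $F_{i,c}$ has a bar between every pair of its joints. Then $F$ is infinitesimally rigid.
   Context: A framework in $\mathbb{R}^d$ is a graph whose vertices (joints) are distinct points of $\mathbb{R}^d$ and whose edges (bars) are segments between joints. An infinitesimal motion of $\mathbb{R}^d$ is a vector field $f:\mathbb{R}^d\to\mathbb{R}^d$ with $(f(x)-f(y))\cdot(x-y)=0$ for all $x,y$. An infinitesimal motion of a framework $F$ with joint set $X$ is a map $g:X\to\mathbb{R}^d$ with $(g(x)-g(y))\cdot(x-y)=0$ for every bar $xy$; $F$ is infinitesimally rigid if every infinitesimal motion of $F$ is the restriction to $X$ of an infinitesimal motion of $\mathbb{R}^d$. An $n$-lattice framework in $\mathbb{R}^d$ is a framework whose joints are the points $(x_1,\ldots,x_d)$ with all $x_i\in\{0,1,\ldots,n-1\}$ (with some set of bars). For such $F$, $F_{i,c}$ denotes the subframework induced by all joints whose $i$-th coordinate equals $c$.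
   Formalization: Infinitesimal motions of the framework and of space are taken over ℚ^d rather than $\mathbb{R}^d$. -}

module Defs where

open import Data.Nat using (ℕ; zero; suc)
open import Data.Fin using (Fin; toℕ)
import Data.Fin as Fin
open import Data.Vec using (Vec; lookup)
open import Data.Integer using (+_)
open import Data.Rational using (ℚ; 0ℚ; _+_; _*_; _-_; _/_)
open import Data.Product using (Σ; _×_)
open import Relation.Binary.PropositionalEquality using (_≡_; _≢_)
open import Function using (_∘_)

-- Points of ℚ^d (ℚ in place of ℝ)
Pt : ℕ → Set
Pt d = Fin d → ℚ

dot : ∀ {d} → Pt d → Pt d → ℚ
dot {zero}  u v = 0ℚ
dot {suc d} u v = u Fin.zero * v Fin.zero + dot (u ∘ Fin.suc) (v ∘ Fin.suc)

_⊖_ : ∀ {d} → Pt d → Pt d → Pt d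
(u ⊖ v) i = u i - v i

Joint : ℕ → ℕ → Set
Joint n d = Vec (Fin n) d

pos : ∀ {n d} → Joint n d → Pt d
pos p i = + toℕ (lookup p i) / 1

record LatticeFramework (n d : ℕ) : Set₁ where
  field
    Bar : Joint n d → Joint n d → Set

open LatticeFramework public

IsSpaceMotion : ∀ {d} → (Pt d → Pt d) → Set
IsSpaceMotion f = ∀ x y → dot (f x ⊖ f y) (x ⊖ y) ≡ 0ℚ

IsMotion : ∀ {n d} → LatticeFramework n d → (Joint n d → Pt d) → Set
IsMotion F g = ∀ p q → Bar F p q → dot (g p ⊖ g q) (pos p ⊖ pos q) ≡ 0ℚ

InfRigid : ∀ {n d} → LatticeFramework n d → Set
InfRigid {n} {d} F =
  ∀ g → IsMotion F g →
    Σ (Pt d → Pt d) λ f → IsSpaceMotion f × (∀ p i → f (pos p) i ≡ g p i)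

SliceComplete : ∀ {n d} → LatticeFramework n d → Fin d → Fin n → Set
SliceComplete F i c =
  ∀ p q → lookup p i ≡ c → lookup q i ≡ c → p ≢ q → Bar F p q

-- A motion g of F is also a motion of the framework that bars every two joints with a
-- common coordinate, since such joints lie in a common complete slice. The values of g at
-- the origin 0 and the unit points e_j determine an affine map f x = g 0 + A x; the bar
-- between e_i and e_j (through a third coordinate, so d ≥ 3) makes A skew-symmetric, hence
-- f is a motion of space. The residual h = g - f vanishes at 0 and every e_j. Comparing with
-- 0 and e_j, h p is a multiple of e_k whenever p_k = 0, and a triangle of three such joints
-- kills that last component. Finally any joint p shares a coordinate with two joints q and
-- q + e_j of the hyperplane x_l = 0, where h vanishes, so h p is orthogonal to e_j.
module Submission where

open import Defs
open import Data.Nat using (ℕ; zero; suc; _≤_; s≤s)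
open import Data.Fin using (Fin; zero; suc; toℕ)
open import Data.Fin.Properties using (suc-injective; _≟_)
open import Data.Vec using (lookup; replicate; _[_]≔_)
open import Data.Vec.Properties using (lookup∘update; lookup∘update′; lookup-replicate; ≡-dec)
import Data.Integer as ℤ
open import Data.Rational using (ℚ; 0ℚ; 1ℚ; ½; _+_; _*_; _-_; _/_)
import Data.Rational.Properties as ℚ
open import Data.Rational.Solver using (module +-*-Solver)
open import Algebra.Properties.Group ℚ.+-0-group using () renaming (x∙y⁻¹≈ε⇒x≈y to x-y≡0⇒x≡y)
open import Data.Product using (∃-syntax; _×_; _,_)
open import Relation.Nullary using (yes; no)
open import Relation.Binary.PropositionalEquality
  using (_≡_; _≢_; refl; sym; trans; cong; cong₂; ≢-sym; module ≡-Reasoning)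
open import Function using (_∘_; case_of_)

open +-*-Solver using (solve; _:=_; _:+_; _:-_; _:*_; con)
open ≡-Reasoning

x+x≡0⇒x≡0 : ∀ x → x + x ≡ 0ℚ → x ≡ 0ℚ
x+x≡0⇒x≡0 x x+x≡0 = begin
  x             ≡⟨ solve 1 (λ x → x := con ½ :* (x :+ x)) refl x ⟩
  ½ * (x + x)   ≡⟨ cong (½ *_) x+x≡0 ⟩
  ½ * 0ℚ        ≡⟨ ℚ.*-zeroʳ ½ ⟩
  0ℚ            ∎

-- U + U = e₂ - e₁ - e₃ as polynomials in U, V, W, a, b.
cyclic-relations⇒≡0 : ∀ {U V W a b : ℚ} →
  U * (0ℚ - 1ℚ) - V * (b - 0ℚ) ≡ 0ℚ → V * (0ℚ - b) - W * (a - 0ℚ) ≡ 0ℚ →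
  W * (0ℚ - a) - U * (1ℚ - 0ℚ) ≡ 0ℚ → U ≡ 0ℚ
cyclic-relations⇒≡0 {U} {V} {W} {a} {b} e₁ e₂ e₃ = x+x≡0⇒x≡0 U (trans
  (solve 5 (λ U V W a b → U :+ U :=
              (V :* (con 0ℚ :- b) :- W :* (a :- con 0ℚ))
           :- (U :* (con 0ℚ :- con 1ℚ) :- V :* (b :- con 0ℚ))
           :- (W :* (con 0ℚ :- a) :- U :* (con 1ℚ :- con 0ℚ))) refl U V W a b)
  (cong₂ _-_ (cong₂ _-_ e₂ e₁) e₃))

IsZero : ∀ {d} → Pt d → Set
IsZero v = ∀ i → v i ≡ 0ℚ

SupportedOn : ∀ {d} → Pt d → Fin d → Set
SupportedOn v a = ∀ i → i ≢ a → v i ≡ 0ℚ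

dot-cong : ∀ {d} {u u′ v v′ : Pt d} → (∀ i → u i ≡ u′ i) → (∀ i → v i ≡ v′ i) →
           dot u v ≡ dot u′ v′
dot-cong {zero}  u≗u′ v≗v′ = refl
dot-cong {suc d} u≗u′ v≗v′ =
  cong₂ _+_ (cong₂ _*_ (u≗u′ zero) (v≗v′ zero)) (dot-cong (u≗u′ ∘ suc) (v≗v′ ∘ suc))

dot-comm : ∀ {d} (u v : Pt d) → dot u v ≡ dot v u
dot-comm {zero}  u v = refl
dot-comm {suc d} u v = cong₂ _+_ (ℚ.*-comm (u zero) (v zero)) (dot-comm (u ∘ suc) (v ∘ suc))

dot-zeroˡ : ∀ {d} {u : Pt d} → IsZero u → ∀ v → dot u v ≡ 0ℚ
dot-zeroˡ {zero}  u≡0 v = refl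
dot-zeroˡ {suc d} u≡0 v = begin
  _                  ≡⟨ cong₂ _+_ (cong (_* v zero) (u≡0 zero))
                                  (dot-zeroˡ (u≡0 ∘ suc) (v ∘ suc)) ⟩
  0ℚ * v zero + 0ℚ   ≡⟨ ℚ.+-identityʳ _ ⟩
  0ℚ * v zero        ≡⟨ ℚ.*-zeroˡ (v zero) ⟩
  0ℚ                 ∎

dot-zeroʳ : ∀ {d} (u : Pt d) {v : Pt d} → IsZero v → dot u v ≡ 0ℚ
dot-zeroʳ u {v} v≡0 = trans (dot-comm u v) (dot-zeroˡ v≡0 u)

dot-addˡ : ∀ {d} (u w v : Pt d) → dot (λ i → u i + w i) v ≡ dot u v + dot w v
dot-addˡ {zero}  u w v = refl
dot-addˡ {suc d} u w v =
  trans (cong (((u zero + w zero) * v zero) +_) (dot-addˡ (u ∘ suc) (w ∘ suc) (v ∘ suc)))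
        (solve 5 (λ a b c x y → (a :+ b) :* c :+ (x :+ y) := (a :* c :+ x) :+ (b :* c :+ y)) refl
           (u zero) (w zero) (v zero) (dot (u ∘ suc) (v ∘ suc)) (dot (w ∘ suc) (v ∘ suc)))

dot-addʳ : ∀ {d} (u v w : Pt d) → dot u (λ i → v i + w i) ≡ dot u v + dot u w
dot-addʳ u v w = begin
  dot u (λ i → v i + w i)   ≡⟨ dot-comm u _ ⟩
  dot (λ i → v i + w i) u   ≡⟨ dot-addˡ v w u ⟩
  dot v u + dot w u         ≡⟨ cong₂ _+_ (dot-comm v u) (dot-comm w u) ⟩
  dot u v + dot u w         ∎

dot-subˡ : ∀ {d} (u w v : Pt d) → dot (u ⊖ w) v ≡ dot u v - dot w v
dot-subˡ {zero}  u w v = refl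
dot-subˡ {suc d} u w v =
  trans (cong (((u zero - w zero) * v zero) +_) (dot-subˡ (u ∘ suc) (w ∘ suc) (v ∘ suc)))
        (solve 5 (λ a b c x y → (a :- b) :* c :+ (x :- y) := (a :* c :+ x) :- (b :* c :+ y)) refl
           (u zero) (w zero) (v zero) (dot (u ∘ suc) (v ∘ suc)) (dot (w ∘ suc) (v ∘ suc)))

dot-subʳ : ∀ {d} (u v w : Pt d) → dot u (v ⊖ w) ≡ dot u v - dot u w
dot-subʳ u v w = begin
  dot u (v ⊖ w)       ≡⟨ dot-comm u _ ⟩
  dot (v ⊖ w) u       ≡⟨ dot-subˡ v w u ⟩
  dot v u - dot w u   ≡⟨ cong₂ _-_ (dot-comm v u) (dot-comm w u) ⟩
  dot u v - dot u w   ∎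

dot-scaleˡ : ∀ {d} (u : Pt d) (a : ℚ) (v : Pt d) → dot (λ i → u i * a) v ≡ a * dot u v
dot-scaleˡ {zero}  u a v = sym (ℚ.*-zeroʳ a)
dot-scaleˡ {suc d} u a v =
  trans (cong ((u zero * a * v zero) +_) (dot-scaleˡ (u ∘ suc) a (v ∘ suc)))
        (solve 4 (λ x a y z → x :* a :* y :+ a :* z := a :* (x :* y :+ z)) refl
           (u zero) a (v zero) (dot (u ∘ suc) (v ∘ suc)))

dot-singleˡ : ∀ {d} {u : Pt d} {a} → SupportedOn u a → ∀ v → dot u v ≡ u a * v a
dot-singleˡ {suc d} {u} {zero} u-a v = begin
  u zero * v zero + dot (u ∘ suc) (v ∘ suc)
    ≡⟨ cong ((u zero * v zero) +_) (dot-zeroˡ (λ i → u-a (suc i) λ ()) (v ∘ suc)) ⟩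
  u zero * v zero + 0ℚ
    ≡⟨ ℚ.+-identityʳ _ ⟩
  u zero * v zero
    ∎
dot-singleˡ {suc d} {u} {suc a} u-a v = begin
  u zero * v zero + dot (u ∘ suc) (v ∘ suc)
    ≡⟨ cong₂ _+_ (cong (_* v zero) (u-a zero λ ()))
                 (dot-singleˡ (λ i i≢a → u-a (suc i) (i≢a ∘ suc-injective)) (v ∘ suc)) ⟩
  0ℚ * v zero + u (suc a) * v (suc a)
    ≡⟨ cong (_+ u (suc a) * v (suc a)) (ℚ.*-zeroˡ (v zero)) ⟩
  0ℚ + u (suc a) * v (suc a)
    ≡⟨ ℚ.+-identityˡ _ ⟩
  u (suc a) * v (suc a)
    ∎

dot-singleʳ : ∀ {d} (u : Pt d) {v : Pt d} {a} → SupportedOn v a → dot u v ≡ u a * v a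
dot-singleʳ u {v} {a} v-a =
  trans (dot-comm u v) (trans (dot-singleˡ v-a u) (ℚ.*-comm (v a) (u a)))

dot-transpose : ∀ {m k} (A : Fin m → Pt k) (z : Pt k) (w : Pt m) →
                dot (λ i → dot (A i) z) w ≡ dot z (λ j → dot (λ i → A i j) w)
dot-transpose {zero}  A z w = sym (dot-zeroʳ z (λ _ → refl))
dot-transpose {suc m} A z w = begin
  dot (A zero) z * w zero + dot (λ i → dot (A (suc i)) z) (w ∘ suc)
    ≡⟨ cong₂ _+_ head (dot-transpose (A ∘ suc) z (w ∘ suc)) ⟩
  dot z (λ j → A zero j * w zero) + dot z (λ j → dot (λ i → A (suc i) j) (w ∘ suc))
    ≡⟨ sym (dot-addʳ z _ _) ⟩
  dot z (λ j → dot (λ i → A i j) w)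
    ∎
  where
  head : dot (A zero) z * w zero ≡ dot z (λ j → A zero j * w zero)
  head = begin
    dot (A zero) z * w zero           ≡⟨ ℚ.*-comm _ (w zero) ⟩
    w zero * dot (A zero) z           ≡⟨ sym (dot-scaleˡ (A zero) (w zero) z) ⟩
    dot (λ j → A zero j * w zero) z   ≡⟨ dot-comm _ z ⟩
    dot z (λ j → A zero j * w zero)   ∎

Skew : ∀ {d} → (Fin d → Pt d) → Set
Skew A = ∀ i j → A i j + A j i ≡ 0ℚ

skew⇒quadratic-form≡0 : ∀ {d} {A : Fin d → Pt d} → Skew A →
                        ∀ z → dot (λ i → dot (A i) z) z ≡ 0ℚ
skew⇒quadratic-form≡0 {A = A} skew z = x+x≡0⇒x≡0 _ (begin
  dot Az z + dot Az z
    ≡⟨ cong₂ _+_ (dot-comm Az z) (dot-transpose A z z) ⟩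
  dot z Az + dot z (λ j → dot (λ i → A i j) z)
    ≡⟨ sym (dot-addʳ z _ _) ⟩
  dot z (λ j → dot (A j) z + dot (λ i → A i j) z)
    ≡⟨ dot-cong (λ _ → refl) (λ j → sym (dot-addˡ (A j) (λ i → A i j) z)) ⟩
  dot z (λ j → dot (λ i → A j i + A i j) z)
    ≡⟨ dot-zeroʳ z (λ j → dot-zeroˡ (skew j) z) ⟩
  0ℚ
    ∎)
  where
  Az : Pt _
  Az i = dot (A i) z

affine : ∀ {d} → Pt d → (Fin d → Pt d) → Pt d → Pt d
affine b A x i = b i + dot (A i) x

skew⇒affine-motion : ∀ {d} {b : Pt d} {A : Fin d → Pt d} → Skew A → IsSpaceMotion (affine b A)
skew⇒affine-motion {b = b} {A} skew x y =
  trans (dot-cong difference (λ _ → refl)) (skew⇒quadratic-form≡0 skew (x ⊖ y))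
  where
  difference : ∀ i → (affine b A x ⊖ affine b A y) i ≡ dot (A i) (x ⊖ y)
  difference i = trans (solve 3 (λ c s t → (c :+ s) :- (c :+ t) := s :- t) refl
                                 (b i) (dot (A i) x) (dot (A i) y))
                       (sym (dot-subʳ (A i) x y))

coord : ∀ {n} → Fin n → ℚ
coord c = ℤ.+ toℕ c / 1

pos-lookup : ∀ {n d} (p : Joint n d) i {c} → lookup p i ≡ c → pos p i ≡ coord c
pos-lookup p i = cong coord

Shares : ∀ {n d} → Joint n d → Joint n d → Set
Shares p q = ∃[ k ] lookup p k ≡ lookup q k

shareFramework : ∀ {n d} → LatticeFramework n d
shareFramework = record { Bar = Shares }

complete-slices⇒share-motion : ∀ {n d} (F : LatticeFramework n d) →
  (∀ i c → SliceComplete F i c) → ∀ {g} → IsMotion F g → IsMotion shareFramework g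
complete-slices⇒share-motion F complete {g} g-motion p q (k , p≡q-at-k) with ≡-dec _≟_ p q
... | yes refl = dot-zeroˡ (λ i → ℚ.+-inverseʳ (g p i)) (pos p ⊖ pos p)
... | no p≢q   = g-motion p q (complete k (lookup p k) p q refl (sym p≡q-at-k) p≢q)

motion-sub-space-motion : ∀ {n d} {F : LatticeFramework n d} {g f} →
  IsMotion F g → IsSpaceMotion f → IsMotion F (λ p → g p ⊖ f (pos p))
motion-sub-space-motion {g = g} {f} g-motion f-motion p q pq = begin
  dot ((g p ⊖ f (pos p)) ⊖ (g q ⊖ f (pos q))) w
    ≡⟨ dot-cong regroup (λ _ → refl) ⟩
  dot ((g p ⊖ g q) ⊖ (f (pos p) ⊖ f (pos q))) w
    ≡⟨ dot-subˡ (g p ⊖ g q) _ w ⟩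
  dot (g p ⊖ g q) w - dot (f (pos p) ⊖ f (pos q)) w
    ≡⟨ cong₂ _-_ (g-motion p q pq) (f-motion (pos p) (pos q)) ⟩
  0ℚ - 0ℚ
    ∎
  where
  w : Pt _
  w = pos p ⊖ pos q
  regroup : ∀ i → ((g p ⊖ f (pos p)) ⊖ (g q ⊖ f (pos q))) i
                  ≡ ((g p ⊖ g q) ⊖ (f (pos p) ⊖ f (pos q))) i
  regroup i = solve 4 (λ a b c e → (a :- b) :- (c :- e) := (a :- c) :- (b :- e)) refl
                      (g p i) (f (pos p) i) (g q i) (f (pos q) i)

motion-orthogonal : ∀ {n d} {F : LatticeFramework n d} {h} → IsMotion F h →
  ∀ {p q} → IsZero (h q) → Bar F p q → dot (h p) (pos p) ≡ dot (h p) (pos q)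
motion-orthogonal {h = h} h-motion {p} {q} hq≡0 pq = x-y≡0⇒x≡y _ _ (begin
  dot (h p) (pos p) - dot (h p) (pos q)   ≡⟨ sym (dot-subʳ (h p) (pos p) (pos q)) ⟩
  dot (h p) w                             ≡⟨ sym (ℚ.+-identityʳ _) ⟩
  dot (h p) w - 0ℚ                        ≡⟨ cong (dot (h p) w -_) (sym (dot-zeroˡ hq≡0 w)) ⟩
  dot (h p) w - dot (h q) w               ≡⟨ sym (dot-subˡ (h p) (h q) w) ⟩
  dot (h p ⊖ h q) w                       ≡⟨ h-motion p q pq ⟩
  0ℚ                                      ∎)
  where
  w : Pt _
  w = pos p ⊖ pos q

motion-edge : ∀ {n d} {F : LatticeFramework n d} {h} → IsMotion F h →
  ∀ {p q a b α β} → Bar F p q → SupportedOn (h p) a → SupportedOn (h q) b →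
  pos p a - pos q a ≡ α → pos p b - pos q b ≡ β → h p a * α - h q b * β ≡ 0ℚ
motion-edge {h = h} h-motion {p} {q} {a} {b} {α} {β} pq hp-a hq-b wa≡α wb≡β = begin
  h p a * α - h q b * β     ≡⟨ cong₂ (λ s t → h p a * s - h q b * t) (sym wa≡α) (sym wb≡β) ⟩
  h p a * w a - h q b * w b ≡⟨ cong₂ _-_ (sym (dot-singleˡ hp-a w)) (sym (dot-singleˡ hq-b w)) ⟩
  dot (h p) w - dot (h q) w ≡⟨ sym (dot-subˡ (h p) (h q) w) ⟩
  dot (h p ⊖ h q) w         ≡⟨ h-motion p q pq ⟩
  0ℚ                        ∎
  where
  w : Pt _
  w = pos p ⊖ pos q

dot-unit-step : ∀ {n d} (u : Pt d) {q : Joint (suc (suc n)) d} {j} → lookup q j ≡ zero →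
                dot u (pos (q [ j ]≔ suc zero) ⊖ pos q) ≡ u j
dot-unit-step u {q} {j} q-j = begin
  dot u (pos q′ ⊖ pos q)      ≡⟨ dot-singleʳ u step-supported ⟩
  u j * (pos q′ j - pos q j)  ≡⟨ cong (u j *_) (cong₂ _-_ (pos-lookup q′ j (lookup∘update j q _))
                                                          (pos-lookup q j q-j)) ⟩
  u j * (1ℚ - 0ℚ)             ≡⟨ ℚ.*-identityʳ (u j) ⟩
  u j                         ∎
  where
  q′ : Joint _ _
  q′ = q [ j ]≔ suc zero
  step-supported : SupportedOn (pos q′ ⊖ pos q) j
  step-supported i i≢j = trans (cong (_- pos q i) (pos-lookup q′ i (lookup∘update′ i≢j q _)))
                               (ℚ.+-inverseʳ (pos q i))

motion-component≡0 : ∀ {n d} {F : LatticeFramework (suc (suc n)) d} {h} → IsMotion F h →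
  ∀ {p q j} → lookup q j ≡ zero → IsZero (h q) → IsZero (h (q [ j ]≔ suc zero)) →
  Bar F p q → Bar F p (q [ j ]≔ suc zero) → h p j ≡ 0ℚ
motion-component≡0 {h = h} h-motion {p} {q} {j} q-j hq≡0 hq′≡0 pq pq′ = begin
  h p j                                   ≡⟨ sym (dot-unit-step (h p) {q} q-j) ⟩
  dot (h p) (pos q′ ⊖ pos q)              ≡⟨ dot-subʳ (h p) (pos q′) (pos q) ⟩
  dot (h p) (pos q′) - dot (h p) (pos q)  ≡⟨ cong₂ _-_ (sym (motion-orthogonal h-motion hq′≡0 pq′))
                                                       (sym (motion-orthogonal h-motion hq≡0 pq)) ⟩
  dot (h p) (pos p) - dot (h p) (pos p)   ≡⟨ ℚ.+-inverseʳ (dot (h p) (pos p)) ⟩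
  0ℚ                                      ∎
  where
  q′ : Joint _ _
  q′ = q [ j ]≔ suc zero

origin : ∀ {n d} → Joint (suc n) d
origin = replicate _ zero

unit : ∀ {n d} → Fin d → Joint (suc (suc n)) d
unit j = origin [ j ]≔ suc zero

lookup-origin : ∀ {n d} (i : Fin d) → lookup (origin {n}) i ≡ zero
lookup-origin i = lookup-replicate i zero

lookup-unit : ∀ {n d} {i j : Fin d} → i ≢ j → lookup (unit {n} j) i ≡ zero
lookup-unit {i = i} i≢j = trans (lookup∘update′ i≢j origin _) (lookup-origin i)

pos-origin : ∀ {n d} → IsZero (pos (origin {n} {d}))
pos-origin {n} i = pos-lookup (origin {n}) i (lookup-origin i)

dot-pos-unit : ∀ {n d} (u : Pt d) j → dot u (pos (unit {n} j)) ≡ u j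
dot-pos-unit {n} u j = begin
  dot u (pos uj)                       ≡⟨ sym (ℚ.+-identityʳ _) ⟩
  dot u (pos uj) - 0ℚ                  ≡⟨ cong (dot u (pos uj) -_)
                                               (sym (dot-zeroʳ u (pos-origin {suc n}))) ⟩
  dot u (pos uj) - dot u (pos origin)  ≡⟨ sym (dot-subʳ u _ _) ⟩
  dot u (pos uj ⊖ pos origin)          ≡⟨ dot-unit-step u {origin} (lookup-origin j) ⟩
  u j                                  ∎
  where
  uj : Joint (suc (suc n)) _
  uj = unit {n} j

frameMatrix : ∀ {n d} → (Joint (suc (suc n)) d → Pt d) → Fin d → Pt d
frameMatrix g i j = g (unit j) i - g origin i

fit : ∀ {n d} → (Joint (suc (suc n)) d → Pt d) → Pt d → Pt d
fit g = affine (g origin) (frameMatrix g)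

fit-origin : ∀ {n d} (g : Joint (suc (suc n)) d → Pt d) i →
             fit g (pos (origin {suc n})) i ≡ g origin i
fit-origin {n} g i = begin
  g origin i + dot (frameMatrix g i) (pos (origin {suc n}))
    ≡⟨ cong (g origin i +_) (dot-zeroʳ (frameMatrix g i) (pos-origin {suc n})) ⟩
  g origin i + 0ℚ
    ≡⟨ ℚ.+-identityʳ _ ⟩
  g origin i
    ∎

fit-unit : ∀ {n d} (g : Joint (suc (suc n)) d → Pt d) j i →
           fit g (pos (unit {n} j)) i ≡ g (unit j) i
fit-unit g j i = begin
  g origin i + dot (frameMatrix g i) (pos (unit j))  ≡⟨ cong (g origin i +_) (dot-pos-unit _ j) ⟩
  g origin i + (g (unit j) i - g origin i)           ≡⟨ solve 2 (λ a b → a :+ (b :- a) := b) refl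
                                                              (g origin i) (g (unit j) i) ⟩
  g (unit j) i                                       ∎

third : ∀ {d} (i j : Fin (suc (suc (suc d)))) → ∃[ k ] k ≢ i × k ≢ j
third zero             zero             = suc zero , (λ ()) , (λ ())
third zero             (suc zero)       = suc (suc zero) , (λ ()) , (λ ())
third zero             (suc (suc j))    = suc zero , (λ ()) , (λ ())
third (suc zero)       zero             = suc (suc zero) , (λ ()) , (λ ())
third (suc zero)       (suc j)          = zero , (λ ()) , (λ ())
third (suc (suc i))    zero             = suc zero , (λ ()) , (λ ())
third (suc (suc i))    (suc j)          = zero , (λ ()) , (λ ())

module _ {n d : ℕ} where
  private
    D : ℕ
    D = suc (suc (suc d))
    Point : Set
    Point = Joint (suc (suc n)) D

  frame-diagonal : {g : Point → Pt D} → IsMotion shareFramework g →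
                   ∀ l → frameMatrix g l l ≡ 0ℚ
  frame-diagonal {g} g-motion l =
    let k , k≢l , _ = third l l in
    trans (sym (dot-unit-step {n} (g (unit l) ⊖ g origin) {origin} (lookup-origin l)))
          (g-motion (unit l) origin
                    (k , trans (lookup-unit k≢l) (sym (lookup-origin k))))

  frame-skew-off-diagonal : {g : Point → Pt D} → IsMotion shareFramework g →
    ∀ {i j} → i ≢ j → frameMatrix g i j + frameMatrix g j i ≡ 0ℚ
  frame-skew-off-diagonal {g} g-motion {i} {j} i≢j = begin
    A i j + A j i
      ≡⟨ solve 6 (λ a b c e x y → (b :- x) :+ (c :- y)
                                 := ((a :- x) :+ (e :- y)) :- ((a :- b) :- (c :- e)))
                 refl (g (unit i) i) (g (unit j) i) (g (unit i) j) (g (unit j) j)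
                      (g origin i) (g origin j) ⟩
    (A i i + A j j) - (u i - u j)
      ≡⟨ cong₂ _-_ (cong₂ _+_ (frame-diagonal {g} g-motion i) (frame-diagonal {g} g-motion j))
                   unit-bar ⟩
    0ℚ + 0ℚ - 0ℚ
      ∎
    where
    A : Fin D → Pt D
    A = frameMatrix g
    u : Pt D
    u = g (unit i) ⊖ g (unit j)
    unit-bar : u i - u j ≡ 0ℚ
    unit-bar = let k , k≢i , k≢j = third i j in begin
      u i - u j
        ≡⟨ sym (cong₂ _-_ (dot-pos-unit {n} u i) (dot-pos-unit {n} u j)) ⟩
      dot u (pos (unit {n} i)) - dot u (pos (unit {n} j))
        ≡⟨ sym (dot-subʳ u (pos (unit {n} i)) (pos (unit {n} j))) ⟩
      dot u (pos (unit {n} i) ⊖ pos (unit {n} j))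
        ≡⟨ g-motion (unit i) (unit j) (k , trans (lookup-unit k≢i) (sym (lookup-unit k≢j))) ⟩
      0ℚ
        ∎

  frame-skew : {g : Point → Pt D} → IsMotion shareFramework g → Skew (frameMatrix g)
  frame-skew {g} g-motion i j = case i ≟ j of λ where
    (yes refl) → cong₂ _+_ (frame-diagonal {g} g-motion i) (frame-diagonal {g} g-motion i)
    (no i≢j)   → frame-skew-off-diagonal {g} g-motion i≢j

  fit-motion : {g : Point → Pt D} → IsMotion shareFramework g → IsSpaceMotion (fit g)
  fit-motion {g} g-motion =
    skew⇒affine-motion {b = g origin} {A = frameMatrix g} (frame-skew {g} g-motion)

  module _ {h : Point → Pt D} (h-motion : IsMotion shareFramework h)
           (h-origin : IsZero (h origin)) (h-unit : ∀ j → IsZero (h (unit j))) where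

    zero-coordinate-support : ∀ p {k} → lookup p k ≡ zero → SupportedOn (h p) k
    zero-coordinate-support p {k} p-k j j≢k =
      motion-component≡0 {h = h} h-motion {p} {origin} {j} (lookup-origin j) h-origin (h-unit j)
        (k , trans p-k (sym (lookup-origin k)))
        (k , trans p-k (sym (lookup-unit (≢-sym j≢k))))

    zero-at-zero-coordinate-via : ∀ p {m x y} → x ≢ m → y ≢ m → y ≢ x →
                                  lookup p m ≡ zero → h p m ≡ 0ℚ
    zero-at-zero-coordinate-via p {m} {x} {y} x≢m y≢m y≢x p-m =
      cyclic-relations⇒≡0 {V = h q y} {W = h r x} {a = pos p x} {b = pos p y} pq qr rp
      where
      p₁ q r : Point
      p₁ = p [ m ]≔ suc zero
      q = p₁ [ y ]≔ zero
      r = p₁ [ x ]≔ zero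
      q-m : lookup q m ≡ suc zero
      q-m = trans (lookup∘update′ (≢-sym y≢m) p₁ zero) (lookup∘update m p (suc zero))
      q-y : lookup q y ≡ zero
      q-y = lookup∘update y p₁ zero
      q-x : lookup q x ≡ lookup p x
      q-x = trans (lookup∘update′ (≢-sym y≢x) p₁ zero) (lookup∘update′ x≢m p (suc zero))
      r-m : lookup r m ≡ suc zero
      r-m = trans (lookup∘update′ (≢-sym x≢m) p₁ zero) (lookup∘update m p (suc zero))
      r-x : lookup r x ≡ zero
      r-x = lookup∘update x p₁ zero
      r-y : lookup r y ≡ lookup p y
      r-y = trans (lookup∘update′ y≢x p₁ zero) (lookup∘update′ y≢m p (suc zero))
      pq : h p m * (0ℚ - 1ℚ) - h q y * (pos p y - 0ℚ) ≡ 0ℚ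
      pq = motion-edge {h = h} h-motion {p} {q} (x , sym q-x)
             (zero-coordinate-support p p-m) (zero-coordinate-support q q-y)
             (cong₂ _-_ (pos-lookup p m p-m) (pos-lookup q m q-m))
             (cong (pos p y -_) (pos-lookup q y q-y))
      qr : h q y * (0ℚ - pos p y) - h r x * (pos p x - 0ℚ) ≡ 0ℚ
      qr = motion-edge {h = h} h-motion {q} {r} (m , trans q-m (sym r-m))
             (zero-coordinate-support q q-y) (zero-coordinate-support r r-x)
             (cong₂ _-_ (pos-lookup q y q-y) (pos-lookup r y r-y))
             (cong₂ _-_ (pos-lookup q x q-x) (pos-lookup r x r-x))
      rp : h r x * (0ℚ - pos p x) - h p m * (1ℚ - 0ℚ) ≡ 0ℚ
      rp = motion-edge {h = h} h-motion {r} {p} (y , r-y)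
             (zero-coordinate-support r r-x) (zero-coordinate-support p p-m)
             (cong (_- pos p x) (pos-lookup r x r-x))
             (cong₂ _-_ (pos-lookup r m r-m) (pos-lookup p m p-m))

    zero-at-zero-coordinate : ∀ p {m} → lookup p m ≡ zero → h p m ≡ 0ℚ
    zero-at-zero-coordinate p {m} p-m =
      let x , x≢m , _   = third m m
          y , y≢m , y≢x = third m x
      in zero-at-zero-coordinate-via p x≢m y≢m y≢x p-m

    vanishes-on-hyperplane : ∀ p {k} → lookup p k ≡ zero → IsZero (h p)
    vanishes-on-hyperplane p {k} p-k i = case i ≟ k of λ where
      (yes refl) → zero-at-zero-coordinate p p-k
      (no i≢k)   → zero-coordinate-support p p-k i i≢k

    component-vanishes-via : ∀ p {j l k} → l ≢ j → k ≢ j → k ≢ l → h p j ≡ 0ℚ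
    component-vanishes-via p {j} {l} {k} l≢j k≢j k≢l =
      motion-component≡0 {h = h} h-motion {p} {q} {j} (lookup∘update j p₀ zero)
        (vanishes-on-hyperplane q q-l) (vanishes-on-hyperplane q′ q′-l)
        (k , p-q-k) (k , trans p-q-k (sym (lookup∘update′ k≢j q (suc zero))))
      where
      p₀ q q′ : Point
      p₀ = p [ l ]≔ zero
      q = p₀ [ j ]≔ zero
      q′ = q [ j ]≔ suc zero
      q-l : lookup q l ≡ zero
      q-l = trans (lookup∘update′ l≢j p₀ zero) (lookup∘update l p zero)
      q′-l : lookup q′ l ≡ zero
      q′-l = trans (lookup∘update′ l≢j q (suc zero)) q-l
      p-q-k : lookup p k ≡ lookup q k
      p-q-k = sym (trans (lookup∘update′ k≢j p₀ zero) (lookup∘update′ k≢l p zero))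

    vanishes : ∀ p → IsZero (h p)
    vanishes p j =
      let l , l≢j , _   = third j j
          k , k≢j , k≢l = third j l
      in component-vanishes-via p l≢j k≢j k≢l

  fit-extends : {g : Point → Pt D} → IsMotion shareFramework g →
                ∀ p i → fit g (pos p) i ≡ g p i
  fit-extends {g} g-motion p i =
    sym (x-y≡0⇒x≡y (g p i) (fit g (pos p) i)
                   (vanishes {h = residual} residual-motion residual-origin residual-unit p i))
    where
    residual : Point → Pt D
    residual p = g p ⊖ fit g (pos p)
    residual-motion : IsMotion shareFramework residual
    residual-motion =
      motion-sub-space-motion {g = g} {f = fit g} g-motion (fit-motion {g} g-motion)
    residual-origin : IsZero (residual origin)
    residual-origin i = trans (cong (g origin i -_) (fit-origin g i)) (ℚ.+-inverseʳ (g origin i))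
    residual-unit : ∀ j → IsZero (residual (unit j))
    residual-unit j i = trans (cong (g (unit j) i -_) (fit-unit g j i)) (ℚ.+-inverseʳ (g (unit j) i))

theorem2p6 : (d n : ℕ) → 3 ≤ d → 2 ≤ n → (F : LatticeFramework n d) →
    (∀ (i : Fin d) (c : Fin n) → SliceComplete F i c) →
    InfRigid F
theorem2p6 _ _ (s≤s (s≤s (s≤s _))) (s≤s (s≤s _)) F complete g g-motion =
  fit g , fit-motion {g = g} share-motion , fit-extends share-motion
  where
  share-motion : IsMotion shareFramework g
  share-motion = complete-slices⇒share-motion F complete {g} g-motion
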